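{- Let $m\ge 2$ be an integer and consider the $m$-element subsets of the set $[2m]=\{1,\dots,2m\}$. If $m$ is not a power of $2$, then these $m$-sets can be coloured Red and Blue so that (i) complementary $m$-sets (i.e. $A$ and $[2m]\setminus A$) have distinct colours, and (ii) every point of $[2m]$ is contained in the same number of Red sets as Blue sets. If $m$ is a power of $2$, then there is a Red–Blue colouring of the $m$-sets of $[2m]$ satisfying (i) such that for $m/2$ of the points of $[2m]$ the number of Red sets containing the point exceeds the number of Blue sets containing it by exactly $3$, and for the remaining $3m/2$ points the number of Blue sets containing the point exceeds the number of Red sets containing it by exactly $1$. -}

module Defs where

open import Data.Nat using (ℕ; zero; suc; _^_; _≟_)
open import Data.Bool using (Bool; true; false)
open import Data.Fin using (Fin)
open import Data.Fin.Subset using (Subset; ∣_∣; _∈_; ∁)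
open import Data.Fin.Subset.Properties using (_∈?_)
open import Data.List using (List; []; _∷_; map; _++_; filter; length)
open import Data.Vec using (Vec; []; _∷_)
open import Data.Product using (∃; _×_)
open import Relation.Binary.PropositionalEquality using (_≡_)
open import Relation.Nullary using (¬_)
open import Relation.Nullary.Decidable using (⌊_⌋)
open import Data.Bool using (_∧_)

IsPowerOf2 : ℕ → Set
IsPowerOf2 m = ∃ λ k → m ≡ 2 ^ k

allSubsets : (n : ℕ) → List (Subset n)
allSubsets zero = [] ∷ []
allSubsets (suc n) = map (true ∷_) (allSubsets n) ++ map (false ∷_) (allSubsets n)

kSets : (n k : ℕ) → List (Subset n)
kSets n k = filter (λ A → ∣ A ∣ ≟ k) (allSubsets n)

-- a Red–Blue colouring: true = Red, false = Blue
Colouring : ℕ → Set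
Colouring n = Subset n → Bool

ComplementDistinct : (m : ℕ) → Colouring (m Data.Nat.+ m) → Set
ComplementDistinct m c = ∀ (A : Subset (m Data.Nat.+ m)) → ∣ A ∣ ≡ m → ¬ (c A ≡ c (∁ A))

count : (n m : ℕ) → Colouring n → Bool → Fin n → ℕ
count n m c b x = length (filter (λ A → x ∈? A) (filter (λ A → c A Data.Bool.≟ b) (kSets n m)))

red blue : (n m : ℕ) → Colouring n → Fin n → ℕ
red n m c = count n m c true
blue n m c = count n m c false

-- View an m-set A of [m + m] as a pair (X , Y) of subsets of [m], its two halves, and call a
-- column j split when exactly one of j ∈ X and j ∈ Y holds.  A colouring g of the subsets of [m]
-- is extended to the m-sets of [m + m] by colouring A with
--   * g X, if no column is split (so A = X ⊔ X);
--   * whether k + 1 ∈ X (cyclically), if k is the only split column;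
--   * X(u) xor X(w) xor X(t), if u < w are the first two split columns and t ∉ {u , w} is one of 0, 1, 2.
-- Complementation reverses each rule.  Fix a point in column j.  Sets of the third kind pair off
-- by swapping the two cells of column u (of w when u = j), which reverses the colour.  Sets of the
-- second kind are permuted by rotating the columns and by exchanging the halves, so every point
-- lies in the same number c_b of them of colour b; counting incidences gives 2m c_b = m T_b for the
-- total number T_b of them of colour b, and complementation gives T_red = T_blue.  So the surplus
-- of red over blue sets at the point is the surplus at j under g (none when m is odd).  Odd m ≥ 3
-- therefore has a balanced colouring, doubling preserves balance, and doubling the colouring of the
-- 2-sets of [4] by "contains 0", with surplus 3 at 0 and -1 elsewhere, handles the powers of 2.

{-# OPTIONS --safe #-}
module Submission where

open import Defs

open import Data.Bool using (Bool; true; false; not; _xor_; if_then_else_)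
import Data.Bool.Properties as Bool
open import Data.Empty using (⊥-elim)
open import Data.Fin using (Fin; zero; suc; _↑ˡ_; _↑ʳ_)
import Data.Fin as Fin
import Data.Fin.Properties as Fin
open import Data.Fin.Induction using (<-weakInduction)
open import Data.Fin.Subset using (Subset; ∣_∣; ∁; _∈_; _∉_; ⁅_⁆)
open import Data.Fin.Subset.Properties using (_∈?_; ∣∁p∣≡n∸∣p∣; x∈⁅x⁆; x∈⁅y⁆⇒x≡y)
open import Data.List using (List; filter; length; map)
import Data.List as List
import Data.List.Properties as Listₚ
open import Data.Nat using (ℕ; zero; suc; _+_; _*_; _∸_; _^_; _≟_; _≡ᵇ_; _≤_; _<_; s≤s; z≤n)
open import Data.Nat.Induction using (<-rec)
open import Data.Nat.ListAction using () renaming (sum to sumₗ)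
open import Data.Nat.ListAction.Properties using () renaming (sum-++ to sumₗ-++)
open import Data.Nat.Properties
open import Algebra.Properties.CommutativeMonoid.Sum +-0-commutativeMonoid using (sum; ∑-distrib-+; sum-cong-≗)
open import Algebra.Properties.CommutativeSemigroup +-commutativeSemigroup
  using () renaming (interchange to +-interchange)
open import Data.Product using (_×_; _,_; proj₁; proj₂; ∃₂; Σ; swap)
import Data.Product as Product
open import Data.Sum using (_⊎_; inj₁; inj₂)
open import Data.Vec using (Vec; []; _∷_; _++_; lookup; take; drop; splitAt; zipWith; _∷ʳ_; init; last; initLast)
open import Data.Vec.Properties
  using (≡-dec; []=⇒lookup; lookup⇒[]=; lookup-map; lookup-zipWith; map-++; zipWith-comm; init-∷ʳ; last-∷ʳ;
         take++drop≡id; ++-injective; lookup-++ˡ; lookup-++ʳ)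
open import Function using (_∘_; id; flip; _⇔_; mk⇔; case_of_)
open import Level using (0ℓ)
open import Relation.Binary.PropositionalEquality
open import Relation.Nullary using (Dec; does; ¬_; yes; no)
open import Relation.Nullary.Decidable using (does-⇔; dec-false)
open import Relation.Unary using (Pred; Decidable)

-- Sums over subsets

infixr 7 [_]·_
[_]·_ : Bool → ℕ → ℕ
[ true  ]· n = n
[ false ]· n = 0

[]·-distrib-+ : ∀ b x y → [ b ]· (x + y) ≡ [ b ]· x + [ b ]· y
[]·-distrib-+ true  x y = refl
[]·-distrib-+ false x y = refl

[]·-cong : ∀ {a b x y} → a ≡ b → (a ≡ true → x ≡ y) → [ a ]· x ≡ [ b ]· y
[]·-cong {true}  refl x≡y = x≡y refl
[]·-cong {false} refl _   = refl

[]·-zero : ∀ b → [ b ]· 0 ≡ 0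
[]·-zero true  = refl
[]·-zero false = refl

[]·-comm : ∀ a b x → [ a ]· [ b ]· x ≡ [ b ]· [ a ]· x
[]·-comm true  b     x = refl
[]·-comm false true  x = refl
[]·-comm false false x = refl

[]·-rotate : ∀ a b c x → [ a ]· [ b ]· [ c ]· x ≡ [ c ]· [ a ]· [ b ]· x
[]·-rotate a b c x = trans (cong ([ a ]·_) ([]·-comm b c x)) ([]·-comm a c ([ b ]· x))

∑ₛ : (n : ℕ) → (Subset n → ℕ) → ℕ
∑ₛ zero    f = f []
∑ₛ (suc n) f = ∑ₛ n (λ A → f (true ∷ A)) + ∑ₛ n (λ A → f (false ∷ A))

infixl 10 ∑ₛ
syntax ∑ₛ n (λ A → e) = ∑[ A ⊆ n ] e

_≟ₛ_ : ∀ {n} (A B : Subset n) → Dec (A ≡ B)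
_≟ₛ_ = ≡-dec Bool._≟_

∑ₛ-cong : ∀ n {f g : Subset n → ℕ} → (∀ A → f A ≡ g A) → ∑ₛ n f ≡ ∑ₛ n g
∑ₛ-cong zero    f≗g = f≗g []
∑ₛ-cong (suc n) f≗g = cong₂ _+_ (∑ₛ-cong n (f≗g ∘ (true ∷_))) (∑ₛ-cong n (f≗g ∘ (false ∷_)))

∑ₛ-zero : ∀ n → ∑[ A ⊆ n ] 0 ≡ 0
∑ₛ-zero zero    = refl
∑ₛ-zero (suc n) = cong₂ _+_ (∑ₛ-zero n) (∑ₛ-zero n)

∑ₛ-distrib-+ : ∀ n (f g : Subset n → ℕ) → ∑[ A ⊆ n ] (f A + g A) ≡ ∑ₛ n f + ∑ₛ n g
∑ₛ-distrib-+ zero    f g = refl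
∑ₛ-distrib-+ (suc n) f g =
  trans (cong₂ _+_ (∑ₛ-distrib-+ n f₁ g₁) (∑ₛ-distrib-+ n f₀ g₀))
        (+-interchange (∑ₛ n f₁) (∑ₛ n g₁) (∑ₛ n f₀) (∑ₛ n g₀))
  where
  f₁ g₁ f₀ g₀ : Subset n → ℕ
  f₁ = f ∘ (true ∷_)
  g₁ = g ∘ (true ∷_)
  f₀ = f ∘ (false ∷_)
  g₀ = g ∘ (false ∷_)

∑ₛ-distribˡ-* : ∀ n k (f : Subset n → ℕ) → ∑[ A ⊆ n ] (k * f A) ≡ k * ∑ₛ n f
∑ₛ-distribˡ-* zero    k f = refl
∑ₛ-distribˡ-* (suc n) k f =
  trans (cong₂ _+_ (∑ₛ-distribˡ-* n k _) (∑ₛ-distribˡ-* n k _)) (sym (*-distribˡ-+ k _ _))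

∑ₛ-comm : ∀ n k (h : Subset n → Subset k → ℕ) →
          ∑[ A ⊆ n ] ∑[ B ⊆ k ] h A B ≡ ∑[ B ⊆ k ] ∑[ A ⊆ n ] h A B
∑ₛ-comm zero    k h = refl
∑ₛ-comm (suc n) k h = begin
  ∑ₛ n (λ A → ∑ₛ k (h (true ∷ A))) + ∑ₛ n (λ A → ∑ₛ k (h (false ∷ A)))
    ≡⟨ cong₂ _+_ (∑ₛ-comm n k _) (∑ₛ-comm n k _) ⟩
  ∑ₛ k (λ B → ∑ₛ n (λ A → h (true ∷ A) B)) + ∑ₛ k (λ B → ∑ₛ n (λ A → h (false ∷ A) B))
    ≡⟨ ∑ₛ-distrib-+ k _ _ ⟨
  ∑ₛ k (λ B → ∑ₛ (suc n) (λ A → h A B)) ∎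
  where open ≡-Reasoning

∑ₛ-δ : ∀ n (A : Subset n) (f : Subset n → ℕ) → ∑[ B ⊆ n ] ([ does (B ≟ₛ A) ]· f B) ≡ f A
∑ₛ-δ zero    []         f = refl
∑ₛ-δ (suc n) (true ∷ A)  f =
  trans (cong₂ _+_ (∑ₛ-δ n A (f ∘ (true ∷_))) (∑ₛ-zero n)) (+-identityʳ _)
∑ₛ-δ (suc n) (false ∷ A) f = cong₂ _+_ (∑ₛ-zero n) (∑ₛ-δ n A (f ∘ (false ∷_)))

∑ₛ-reindex : ∀ n (e e⁻¹ : Subset n → Subset n) →
             (∀ A → e⁻¹ (e A) ≡ A) → (∀ A → e (e⁻¹ A) ≡ A) →
             (f : Subset n → ℕ) → ∑[ A ⊆ n ] f (e A) ≡ ∑ₛ n f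
∑ₛ-reindex n e e⁻¹ e⁻¹∘e e∘e⁻¹ f = begin
  ∑[ A ⊆ n ] f (e A)
    ≡⟨ ∑ₛ-cong n (λ A → ∑ₛ-δ n (e A) f) ⟨
  ∑[ A ⊆ n ] ∑[ B ⊆ n ] ([ does (B ≟ₛ e A) ]· f B)
    ≡⟨ ∑ₛ-comm n n _ ⟩
  ∑[ B ⊆ n ] ∑[ A ⊆ n ] ([ does (B ≟ₛ e A) ]· f B)
    ≡⟨ ∑ₛ-cong n (λ B → ∑ₛ-cong n (λ A →
         cong ([_]· f B) (does-⇔ (transpose A B) (B ≟ₛ e A) (A ≟ₛ e⁻¹ B)))) ⟩
  ∑[ B ⊆ n ] ∑[ A ⊆ n ] ([ does (A ≟ₛ e⁻¹ B) ]· f B)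
    ≡⟨ ∑ₛ-cong n (λ B → ∑ₛ-δ n (e⁻¹ B) (λ _ → f B)) ⟩
  ∑ₛ n f ∎
  where
  open ≡-Reasoning
  transpose : ∀ A B → B ≡ e A ⇔ A ≡ e⁻¹ B
  transpose A B = mk⇔ (λ { refl → sym (e⁻¹∘e A) }) (λ { refl → sym (e∘e⁻¹ B) })

∑ₛ-++ : ∀ m k (f : Subset (m + k) → ℕ) → ∑ₛ (m + k) f ≡ ∑[ xs ⊆ m ] ∑[ ys ⊆ k ] f (xs ++ ys)
∑ₛ-++ zero    k f = refl
∑ₛ-++ (suc m) k f = cong₂ _+_ (∑ₛ-++ m k (f ∘ (true ∷_))) (∑ₛ-++ m k (f ∘ (false ∷_)))

sum-const : ∀ n c → sum {n} (λ _ → c) ≡ n * c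
sum-const zero    c = refl
sum-const (suc n) c = cong (c +_) (sum-const n c)

double-counting : ∀ n (w : Subset n → ℕ) →
                  sum (λ x → ∑[ A ⊆ n ] ([ lookup A x ]· w A)) ≡ ∑[ A ⊆ n ] (∣ A ∣ * w A)
double-counting zero    w = refl
double-counting (suc n) w = begin
  (∑ₛ n w₁ + ∑[ A ⊆ n ] 0) + sum (λ x → count₁ x + count₀ x)
    ≡⟨ cong₂ _+_ (trans (cong (∑ₛ n w₁ +_) (∑ₛ-zero n)) (+-identityʳ (∑ₛ n w₁)))
                 (∑-distrib-+ count₁ count₀) ⟩
  ∑ₛ n w₁ + (sum count₁ + sum count₀)
    ≡⟨ cong (∑ₛ n w₁ +_) (cong₂ _+_ (double-counting n w₁) (double-counting n w₀)) ⟩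
  ∑ₛ n w₁ + (∑[ A ⊆ n ] (∣ A ∣ * w₁ A) + ∑[ A ⊆ n ] (∣ A ∣ * w₀ A))
    ≡⟨ +-assoc (∑ₛ n w₁) _ _ ⟨
  (∑ₛ n w₁ + ∑[ A ⊆ n ] (∣ A ∣ * w₁ A)) + ∑[ A ⊆ n ] (∣ A ∣ * w₀ A)
    ≡⟨ cong (_+ ∑[ A ⊆ n ] (∣ A ∣ * w₀ A)) (∑ₛ-distrib-+ n w₁ (λ A → ∣ A ∣ * w₁ A)) ⟨
  ∑[ A ⊆ suc n ] (∣ A ∣ * w A) ∎
  where
  open ≡-Reasoning
  w₁ w₀ : Subset n → ℕ
  w₁ = w ∘ (true ∷_)
  w₀ = w ∘ (false ∷_)
  count₁ count₀ : Fin n → ℕ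
  count₁ x = ∑[ A ⊆ n ] ([ lookup A x ]· w₁ A)
  count₀ x = ∑[ A ⊆ n ] ([ lookup A x ]· w₀ A)

-- Counting coloured m-sets

sum-map-filter : ∀ {A : Set} {P : Pred A 0ℓ} (P? : Decidable P) (f : A → ℕ) (as : List A) →
                 sumₗ (map f (filter P? as)) ≡ sumₗ (map (λ a → [ does (P? a) ]· f a) as)
sum-map-filter P? f List.[] = refl
sum-map-filter P? f (a List.∷ as) with does (P? a)
... | true  = cong (f a +_) (sum-map-filter P? f as)
... | false = sum-map-filter P? f as

length≡sum-map-1 : ∀ {A : Set} (as : List A) → length as ≡ sumₗ (map (λ _ → 1) as)
length≡sum-map-1 List.[]        = refl
length≡sum-map-1 (a List.∷ as) = cong suc (length≡sum-map-1 as)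

sum-map-allSubsets : ∀ n (f : Subset n → ℕ) → sumₗ (map f (allSubsets n)) ≡ ∑ₛ n f
sum-map-allSubsets zero    f = +-identityʳ (f [])
sum-map-allSubsets (suc n) f = begin
  sumₗ (map f (map (true ∷_) (allSubsets n) List.++ map (false ∷_) (allSubsets n)))
    ≡⟨ cong sumₗ (Listₚ.map-++ f (map (true ∷_) (allSubsets n)) _) ⟩
  sumₗ (map f (map (true ∷_) (allSubsets n)) List.++ map f (map (false ∷_) (allSubsets n)))
    ≡⟨ sumₗ-++ (map f (map (true ∷_) (allSubsets n))) _ ⟩
  sumₗ (map f (map (true ∷_) (allSubsets n))) + sumₗ (map f (map (false ∷_) (allSubsets n)))
    ≡⟨ cong₂ (λ l l′ → sumₗ l + sumₗ l′) (Listₚ.map-∘ (allSubsets n)) (Listₚ.map-∘ (allSubsets n)) ⟨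
  sumₗ (map (f ∘ (true ∷_)) (allSubsets n)) + sumₗ (map (f ∘ (false ∷_)) (allSubsets n))
    ≡⟨ cong₂ _+_ (sum-map-allSubsets n (f ∘ (true ∷_))) (sum-map-allSubsets n (f ∘ (false ∷_))) ⟩
  ∑ₛ (suc n) f ∎
  where open ≡-Reasoning

count≡∑ₛ : ∀ n m c b x → count n m c b x ≡
           ∑[ A ⊆ n ] ([ does (∣ A ∣ ≟ m) ]· [ does (c A Bool.≟ b) ]· [ does (x ∈? A) ]· 1)
count≡∑ₛ n m c b x = begin
  length (filter (x ∈?_) coloured)
    ≡⟨ length≡sum-map-1 (filter (x ∈?_) coloured) ⟩
  sumₗ (map (λ _ → 1) (filter (x ∈?_) coloured))
    ≡⟨ sum-map-filter (x ∈?_) _ coloured ⟩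
  sumₗ (map (λ A → [ does (x ∈? A) ]· 1) (filter (λ A → c A Bool.≟ b) (kSets n m)))
    ≡⟨ sum-map-filter (λ A → c A Bool.≟ b) _ (kSets n m) ⟩
  sumₗ (map (λ A → [ does (c A Bool.≟ b) ]· [ does (x ∈? A) ]· 1) (kSets n m))
    ≡⟨ sum-map-filter (λ A → ∣ A ∣ ≟ m) _ (allSubsets n) ⟩
  sumₗ (map (λ A → [ does (∣ A ∣ ≟ m) ]· [ does (c A Bool.≟ b) ]· [ does (x ∈? A) ]· 1) (allSubsets n))
    ≡⟨ sum-map-allSubsets n _ ⟩
  ∑[ A ⊆ n ] ([ does (∣ A ∣ ≟ m) ]· [ does (c A Bool.≟ b) ]· [ does (x ∈? A) ]· 1) ∎
  where
  open ≡-Reasoning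
  coloured : List (Subset n)
  coloured = filter (λ A → c A Bool.≟ b) (kSets n m)

does-∈? : ∀ {n} (x : Fin n) (A : Subset n) → does (x ∈? A) ≡ lookup A x
does-∈? zero    (true  ∷ A) = refl
does-∈? zero    (false ∷ A) = refl
does-∈? (suc x) (a ∷ A)     = does-∈? x A

-- Cyclic rotation

rot : ∀ {A : Set} {n} → Vec A (suc n) → Vec A (suc n)
rot (x ∷ xs) = xs ∷ʳ x

unrot : ∀ {A : Set} {n} → Vec A (suc n) → Vec A (suc n)
unrot xs = last xs ∷ init xs

unrot-rot : ∀ {A : Set} {n} (xs : Vec A (suc n)) → unrot (rot xs) ≡ xs
unrot-rot (x ∷ xs) = cong₂ _∷_ (last-∷ʳ x xs) (init-∷ʳ x xs)

rot-unrot : ∀ {A : Set} {n} (xs : Vec A (suc n)) → rot (unrot xs) ≡ xs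
rot-unrot xs = sym (proj₂ (proj₂ (initLast xs)))

sucmod : ∀ {n} → Fin (suc n) → Fin (suc n)
sucmod {zero}  zero    = zero
sucmod {suc n} zero    = suc zero
sucmod {suc n} (suc i) = sucUnlessWrapped (sucmod i)
  where
  sucUnlessWrapped : Fin (suc n) → Fin (suc (suc n))
  sucUnlessWrapped zero    = zero
  sucUnlessWrapped (suc k) = suc (suc k)

lookup-rot : ∀ {A : Set} {n} (xs : Vec A (suc n)) i → lookup (rot xs) i ≡ lookup xs (sucmod i)
lookup-rot (x ∷ [])     zero    = refl
lookup-rot (x ∷ y ∷ ys) zero    = refl
lookup-rot (x ∷ y ∷ ys) (suc i) with sucmod i | lookup-rot (x ∷ ys) i
... | zero  | eq = eq
... | suc k | eq = eq

sucmod-inject₁ : ∀ {n} (i : Fin n) → sucmod (Fin.inject₁ i) ≡ suc i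
sucmod-inject₁ {suc n} zero    = refl
sucmod-inject₁ {suc n} (suc i) rewrite sucmod-inject₁ i = refl

sucmod-≢ : ∀ {n} (i : Fin (suc (suc n))) → sucmod i ≢ i
sucmod-≢ zero ()
sucmod-≢ {zero}  (suc zero) ()
sucmod-≢ {suc n} (suc i) eq with sucmod i | sucmod-≢ i
... | zero  | _   = Fin.0≢1+n eq
... | suc k | k≢i = k≢i (Fin.suc-injective eq)

∣∷ʳ∣ : ∀ {n} (xs : Subset n) x → ∣ xs ∷ʳ x ∣ ≡ ∣ x ∷ xs ∣
∣∷ʳ∣ []           x     = refl
∣∷ʳ∣ (true ∷ xs)  true  = cong suc (∣∷ʳ∣ xs true)
∣∷ʳ∣ (true ∷ xs)  false = cong suc (∣∷ʳ∣ xs false)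
∣∷ʳ∣ (false ∷ xs) x     = ∣∷ʳ∣ xs x

∣rot∣ : ∀ {n} (xs : Subset (suc n)) → ∣ rot xs ∣ ≡ ∣ xs ∣
∣rot∣ (x ∷ xs) = ∣∷ʳ∣ xs x

zipWith-∷ʳ : ∀ {A B C : Set} {n} (f : A → B → C) (xs : Vec A n) ys x y →
             zipWith f (xs ∷ʳ x) (ys ∷ʳ y) ≡ zipWith f xs ys ∷ʳ f x y
zipWith-∷ʳ f []       []       x y = refl
zipWith-∷ʳ f (x′ ∷ xs) (y′ ∷ ys) x y = cong (f x′ y′ ∷_) (zipWith-∷ʳ f xs ys x y)

rot-zipWith : ∀ {A B C : Set} {n} (f : A → B → C) (xs : Vec A (suc n)) ys →
              rot (zipWith f xs ys) ≡ zipWith f (rot xs) (rot ys)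
rot-zipWith f (x ∷ xs) (y ∷ ys) = sym (zipWith-∷ʳ f xs ys x y)

-- Classifying a subset by its first two elements

data Splitting (m : ℕ) : Set where
  none : Splitting m
  one  : Fin m → Splitting m
  many : Fin m → Fin m → Splitting m

shift : ∀ {m} → Splitting m → Splitting (suc m)
shift none       = none
shift (one k)    = one (suc k)
shift (many u w) = many (suc u) (suc w)

addZero : ∀ {m} → Splitting m → Splitting (suc m)
addZero none       = one zero
addZero (one k)    = many zero (suc k)
addZero (many u _) = many zero (suc u)

classify : ∀ {m} → Subset m → Splitting m
classify []          = none
classify (true ∷ v)  = addZero (classify v)
classify (false ∷ v) = shift (classify v)

isNone isOne isMany : ∀ {m} → Splitting m → Bool
isNone none = true
isNone _    = false
isOne (one _) = true
isOne _       = false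
isMany (many _ _) = true
isMany _          = false

isOne⇒one : ∀ {m} {c : Splitting m} → isOne c ≡ true → Σ (Fin m) λ k → c ≡ one k
isOne⇒one {c = one k} _ = k , refl

isNone-classify : ∀ {m} (v : Subset m) → isNone (classify v) ≡ (∣ v ∣ ≡ᵇ 0)
isNone-classify []          = refl
isNone-classify (true ∷ v)  with classify v
... | none     = refl
... | one _    = refl
... | many _ _ = refl
isNone-classify (false ∷ v) with classify v | isNone-classify v
... | none     | eq = eq
... | one _    | eq = eq
... | many _ _ | eq = eq

isOne-classify : ∀ {m} (v : Subset m) → isOne (classify v) ≡ (∣ v ∣ ≡ᵇ 1)
isOne-classify []          = refl
isOne-classify (true ∷ v)  with classify v | isNone-classify v
... | none     | eq = eq
... | one _    | eq = eq
... | many _ _ | eq = eq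
isOne-classify (false ∷ v) with classify v | isOne-classify v
... | none     | eq = eq
... | one _    | eq = eq
... | many _ _ | eq = eq

classify-none : ∀ {m} (v : Subset m) → classify v ≡ none → ∀ l → lookup v l ≡ false
classify-none (true ∷ v)  eq with classify v
classify-none (true ∷ v)  () | none
classify-none (true ∷ v)  () | one _
classify-none (true ∷ v)  () | many _ _
classify-none (false ∷ v) eq with classify v in cv
classify-none (false ∷ v) refl | none = λ where
  zero    → refl
  (suc l) → classify-none v cv l

Unique : ∀ {m} → Subset m → Fin m → Set
Unique v k = lookup v k ≡ true × (∀ l → lookup v l ≡ true → l ≡ k)

classify-one : ∀ {m} (v : Subset m) {k} → classify v ≡ one k → Unique v k
classify-one (true ∷ v)  eq with classify v in cv
classify-one (true ∷ v)  refl | none = refl , λ where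
  zero    _  → refl
  (suc l) vₗ → case trans (sym vₗ) (classify-none v cv l) of λ ()
classify-one (false ∷ v) eq with classify v in cv
classify-one (false ∷ v) refl | one k with classify-one v cv
... | vₖ , uniq = vₖ , λ where
  (suc l) vₗ → cong suc (uniq l vₗ)

classify-many : ∀ {m} (v : Subset m) {u w} → classify v ≡ many u w →
                lookup v u ≡ true × lookup v w ≡ true × u ≢ w
classify-many (true ∷ v)  eq with classify v in cv
classify-many (true ∷ v)  refl | one k with classify-one v cv
... | vₖ , _ = refl , vₖ , λ ()
classify-many (true ∷ v)  refl | many u _ with classify-many v cv
... | vᵤ , _ = refl , vᵤ , λ ()
classify-many (false ∷ v) eq with classify v in cv
classify-many (false ∷ v) refl | many u w with classify-many v cv
... | vᵤ , v_w , u≢w = vᵤ , v_w , u≢w ∘ Fin.suc-injective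

-- Subsets of [m + m] as pairs of subsets of [m]

Halves : ℕ → Set
Halves m = Subset m × Subset m

join : ∀ {m} → Halves m → Subset (m + m)
join (xs , ys) = xs ++ ys

halves : ∀ m → Subset (m + m) → Halves m
halves m A = take m A , drop m A

halves-join : ∀ {m} (P : Halves m) → halves m (join P) ≡ P
halves-join {m} (xs , ys) with splitAt m (xs ++ ys)
... | xs′ , ys′ , eq with ++-injective xs xs′ eq
... | refl , refl = refl

join-halves : ∀ m (A : Subset (m + m)) → join (halves m A) ≡ A
join-halves m A = take++drop≡id m A

∣++∣ : ∀ {m k} (xs : Subset m) (ys : Subset k) → ∣ xs ++ ys ∣ ≡ ∣ xs ∣ + ∣ ys ∣
∣++∣ []           ys = refl
∣++∣ (true  ∷ xs) ys = cong suc (∣++∣ xs ys)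
∣++∣ (false ∷ xs) ys = ∣++∣ xs ys

∣_∣ₕ : ∀ {m} → Halves m → ℕ
∣ xs , ys ∣ₕ = ∣ xs ∣ + ∣ ys ∣

∣halves∣ : ∀ m (A : Subset (m + m)) → ∣ halves m A ∣ₕ ≡ ∣ A ∣
∣halves∣ m A = trans (sym (∣++∣ (proj₁ (halves m A)) (proj₂ (halves m A)))) (cong ∣_∣ (join-halves m A))

half : ∀ {m} → Bool → Halves m → Subset m
half true  = proj₁
half false = proj₂

half-diagonal : ∀ {m} {xs : Subset m} s → half s (xs , xs) ≡ xs
half-diagonal true  = refl
half-diagonal false = refl

point : ∀ {m} → Fin m → Bool → Fin (m + m)
point {m} j true  = j ↑ˡ m
point {m} j false = m ↑ʳ j

point-surjective : ∀ {m} (x : Fin (m + m)) → ∃₂ λ j s → point j s ≡ x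
point-surjective {m} x with Fin.splitAt m x in eq
... | inj₁ j = j , true  , Fin.splitAt⁻¹-↑ˡ eq
... | inj₂ j = j , false , Fin.splitAt⁻¹-↑ʳ eq

lookup-join : ∀ {m} (P : Halves m) j s → lookup (join P) (point j s) ≡ lookup (half s P) j
lookup-join (xs , ys) j true  = lookup-++ˡ xs ys j
lookup-join (xs , ys) j false = lookup-++ʳ xs ys j

∑ₕ : (m : ℕ) → (Halves m → ℕ) → ℕ
∑ₕ m f = ∑[ xs ⊆ m ] ∑[ ys ⊆ m ] f (xs , ys)

infixl 10 ∑ₕ
syntax ∑ₕ m (λ P → e) = ∑[ P ⊆² m ] e

∑ₕ-cong : ∀ m {f g : Halves m → ℕ} → (∀ P → f P ≡ g P) → ∑ₕ m f ≡ ∑ₕ m g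
∑ₕ-cong m f≗g = ∑ₛ-cong m (λ xs → ∑ₛ-cong m (λ ys → f≗g (xs , ys)))

∑ₕ-distrib-+ : ∀ m (f g : Halves m → ℕ) → ∑[ P ⊆² m ] (f P + g P) ≡ ∑ₕ m f + ∑ₕ m g
∑ₕ-distrib-+ m f g = trans (∑ₛ-cong m (λ xs → ∑ₛ-distrib-+ m (λ ys → f (xs , ys)) (λ ys → g (xs , ys))))
                           (∑ₛ-distrib-+ m _ _)

∑ₛ-halves : ∀ m (f : Halves m → ℕ) → ∑[ A ⊆ m + m ] f (halves m A) ≡ ∑ₕ m f
∑ₛ-halves m f = trans (∑ₛ-++ m m (f ∘ halves m))
  (∑ₛ-cong m (λ xs → ∑ₛ-cong m (λ ys → cong f (halves-join (xs , ys)))))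

∑ₕ-reindex : ∀ m (e e⁻¹ : Halves m → Halves m) →
             (∀ P → e⁻¹ (e P) ≡ P) → (∀ P → e (e⁻¹ P) ≡ P) →
             (f : Halves m → ℕ) → ∑[ P ⊆² m ] f (e P) ≡ ∑ₕ m f
∑ₕ-reindex m e e⁻¹ e⁻¹∘e e∘e⁻¹ f = begin
  ∑[ P ⊆² m ] f (e P)                     ≡⟨ ∑ₛ-halves m (f ∘ e) ⟨
  ∑[ A ⊆ m + m ] f (e (halves m A))       ≡⟨ ∑ₛ-cong (m + m) (λ A → cong f (halves-join (e (halves m A)))) ⟨
  ∑[ A ⊆ m + m ] f (halves m (lift e A))  ≡⟨ ∑ₛ-reindex (m + m) (lift e) (lift e⁻¹)
                                               (lift-inverse e e⁻¹ e⁻¹∘e) (lift-inverse e⁻¹ e e∘e⁻¹) (f ∘ halves m) ⟩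
  ∑[ A ⊆ m + m ] f (halves m A)           ≡⟨ ∑ₛ-halves m f ⟩
  ∑ₕ m f                                  ∎
  where
  open ≡-Reasoning
  lift : (Halves m → Halves m) → Subset (m + m) → Subset (m + m)
  lift φ = join ∘ φ ∘ halves m
  lift-inverse : ∀ φ ψ → (∀ P → ψ (φ P) ≡ P) → ∀ A → lift ψ (lift φ A) ≡ A
  lift-inverse φ ψ ψ∘φ A = trans (cong (join ∘ ψ) (halves-join (φ (halves m A))))
                                 (trans (cong join (ψ∘φ (halves m A))) (join-halves m A))

count-point : ∀ m (κ : Halves m → Bool) b j s →
  count (m + m) m (κ ∘ halves m) b (point j s) ≡
  ∑[ P ⊆² m ] ([ lookup (half s P) j ]· [ does (∣ P ∣ₕ ≟ m) ]· [ does (κ P Bool.≟ b) ]· 1)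
count-point m κ b j s = begin
  count (m + m) m (κ ∘ halves m) b (point j s)
    ≡⟨ count≡∑ₛ (m + m) m (κ ∘ halves m) b (point j s) ⟩
  ∑[ A ⊆ m + m ] ([ does (∣ A ∣ ≟ m) ]· [ does (κ (halves m A) Bool.≟ b) ]· [ does (point j s ∈? A) ]· 1)
    ≡⟨ trans (∑ₛ-++ m m _) (∑ₛ-cong m (λ xs → ∑ₛ-cong m (λ ys → summand (xs , ys)))) ⟩
  ∑[ P ⊆² m ] ([ lookup (half s P) j ]· [ does (∣ P ∣ₕ ≟ m) ]· [ does (κ P Bool.≟ b) ]· 1) ∎
  where
  open ≡-Reasoning
  summand : ∀ P →
    [ does (∣ join P ∣ ≟ m) ]· [ does (κ (halves m (join P)) Bool.≟ b) ]· [ does (point j s ∈? join P) ]· 1 ≡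
    [ lookup (half s P) j ]· [ does (∣ P ∣ₕ ≟ m) ]· [ does (κ P Bool.≟ b) ]· 1
  summand P rewrite ∣++∣ (proj₁ P) (proj₂ P) | halves-join P | does-∈? (point j s) (join P) | lookup-join P j s =
    []·-rotate (does (∣ P ∣ₕ ≟ m)) (does (κ P Bool.≟ b)) (lookup (half s P) j) 1

splits : ∀ {m} → Halves m → Subset m
splits (xs , ys) = zipWith _xor_ xs ys

xor≡false : ∀ {x y} → x xor y ≡ false → x ≡ y
xor≡false {true}  {true}  _ = refl
xor≡false {false} {false} _ = refl

unsplit-column : ∀ {m} (P : Halves m) l → lookup (splits P) l ≡ false →
                 lookup (proj₁ P) l ≡ lookup (proj₂ P) l
unsplit-column (xs , ys) l unsplit = xor≡false (trans (sym (lookup-zipWith _xor_ l xs ys)) unsplit)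

unsplit⇒diagonal : ∀ {m} (P : Halves m) → (∀ l → lookup (splits P) l ≡ false) → proj₁ P ≡ proj₂ P
unsplit⇒diagonal ([] , [])          _       = refl
unsplit⇒diagonal (x ∷ xs , y ∷ ys) unsplit =
  cong₂ _∷_ (unsplit-column (x ∷ xs , y ∷ ys) zero (unsplit zero)) (unsplit⇒diagonal (xs , ys) (unsplit ∘ suc))

∑ₛ-unsplit : ∀ {m} (xs : Subset m) (f : Subset m → ℕ) →
             ∑[ ys ⊆ m ] ([ ∣ splits (xs , ys) ∣ ≡ᵇ 0 ]· f ys) ≡ f xs
∑ₛ-unsplit []           f = refl
∑ₛ-unsplit {suc m} (true  ∷ xs) f =
  trans (cong₂ _+_ (∑ₛ-unsplit xs (f ∘ (true ∷_))) (∑ₛ-zero m)) (+-identityʳ (f (true ∷ xs)))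
∑ₛ-unsplit {suc m} (false ∷ xs) f = cong₂ _+_ (∑ₛ-zero m) (∑ₛ-unsplit xs (f ∘ (false ∷_)))

classify-diagonal : ∀ {m} (xs : Subset m) → classify (splits (xs , xs)) ≡ none
classify-diagonal []           = refl
classify-diagonal (true  ∷ xs) rewrite classify-diagonal xs = refl
classify-diagonal (false ∷ xs) rewrite classify-diagonal xs = refl

not-xor-not : ∀ x y → not x xor not y ≡ x xor y
not-xor-not true  y = refl
not-xor-not false y = Bool.not-involutive y

not-≟-true : ∀ κ → does (not κ Bool.≟ true) ≡ does (κ Bool.≟ false)
not-≟-true true  = refl
not-≟-true false = refl

∁ₕ : ∀ {m} → Halves m → Halves m
∁ₕ = Product.map ∁ ∁

∁ₕ-involutive : ∀ {m} (P : Halves m) → ∁ₕ (∁ₕ P) ≡ P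
∁ₕ-involutive (xs , ys) = cong₂ _,_ (∁-involutive xs) (∁-involutive ys)
  where
  ∁-involutive : ∀ {m} (p : Subset m) → ∁ (∁ p) ≡ p
  ∁-involutive []      = refl
  ∁-involutive (x ∷ p) = cong₂ _∷_ (Bool.not-involutive x) (∁-involutive p)

∁-join : ∀ {m} (P : Halves m) → ∁ (join P) ≡ join (∁ₕ P)
∁-join (xs , ys) = map-++ not xs ys

splits-∁ₕ : ∀ {m} (P : Halves m) → splits (∁ₕ P) ≡ splits P
splits-∁ₕ ([] , [])          = refl
splits-∁ₕ (x ∷ xs , y ∷ ys) = cong₂ _∷_ (not-xor-not x y) (splits-∁ₕ (xs , ys))

∣∁ₕ∣ : ∀ {m} (P : Halves m) → ∣ P ∣ₕ ≡ m → ∣ ∁ₕ P ∣ₕ ≡ m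
∣∁ₕ∣ {m} (xs , ys) ∣P∣≡m = begin
  ∣ ∁ xs ∣ + ∣ ∁ ys ∣          ≡⟨ cong₂ _+_ (∣∁p∣≡n∸∣p∣ xs) (∣∁p∣≡n∸∣p∣ ys) ⟩
  (m ∸ ∣ xs ∣) + (m ∸ ∣ ys ∣)  ≡⟨ cong (λ k → (k ∸ ∣ xs ∣) + (k ∸ ∣ ys ∣)) ∣P∣≡m ⟨
  ((∣ xs ∣ + ∣ ys ∣) ∸ ∣ xs ∣) + ((∣ xs ∣ + ∣ ys ∣) ∸ ∣ ys ∣)
                               ≡⟨ cong₂ _+_ (m+n∸m≡n ∣ xs ∣ ∣ ys ∣) (m+n∸n≡m ∣ xs ∣ ∣ ys ∣) ⟩
  ∣ ys ∣ + ∣ xs ∣              ≡⟨ +-comm ∣ ys ∣ ∣ xs ∣ ⟩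
  ∣ xs ∣ + ∣ ys ∣              ≡⟨ ∣P∣≡m ⟩
  m                            ∎
  where open ≡-Reasoning

splits-swap : ∀ {m} (P : Halves m) → splits (swap P) ≡ splits P
splits-swap (xs , ys) = zipWith-comm Bool.xor-comm ys xs

rotₕ unrotₕ : ∀ {m} → Halves (suc m) → Halves (suc m)
rotₕ   = Product.map rot rot
unrotₕ = Product.map unrot unrot

unrotₕ-rotₕ : ∀ {m} (P : Halves (suc m)) → unrotₕ (rotₕ P) ≡ P
unrotₕ-rotₕ (xs , ys) = cong₂ _,_ (unrot-rot xs) (unrot-rot ys)

rotₕ-unrotₕ : ∀ {m} (P : Halves (suc m)) → rotₕ (unrotₕ P) ≡ P
rotₕ-unrotₕ (xs , ys) = cong₂ _,_ (rot-unrot xs) (rot-unrot ys)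

splits-rotₕ : ∀ {m} (P : Halves (suc m)) → splits (rotₕ P) ≡ rot (splits P)
splits-rotₕ (xs , ys) = sym (rot-zipWith _xor_ xs ys)

∣rotₕ∣ : ∀ {m} (P : Halves (suc m)) → ∣ rotₕ P ∣ₕ ≡ ∣ P ∣ₕ
∣rotₕ∣ (xs , ys) = cong₂ _+_ (∣rot∣ xs) (∣rot∣ ys)

half-rotₕ : ∀ {m} s (P : Halves (suc m)) → half s (rotₕ P) ≡ rot (half s P)
half-rotₕ true  P = refl
half-rotₕ false P = refl

flipAt : ∀ {m} → Fin m → Halves m → Halves m
flipAt zero    (x ∷ xs , y ∷ ys) = y ∷ xs , x ∷ ys
flipAt (suc i) (x ∷ xs , y ∷ ys) = Product.map (x ∷_) (y ∷_) (flipAt i (xs , ys))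

flipAt-involutive : ∀ {m} (i : Fin m) P → flipAt i (flipAt i P) ≡ P
flipAt-involutive zero    (x ∷ xs , y ∷ ys) = refl
flipAt-involutive (suc i) (x ∷ xs , y ∷ ys) =
  cong (Product.map (x ∷_) (y ∷_)) (flipAt-involutive i (xs , ys))

splits-flipAt : ∀ {m} (i : Fin m) P → splits (flipAt i P) ≡ splits P
splits-flipAt zero    (x ∷ xs , y ∷ ys) = cong (_∷ zipWith _xor_ xs ys) (Bool.xor-comm y x)
splits-flipAt (suc i) (x ∷ xs , y ∷ ys) = cong ((x xor y) ∷_) (splits-flipAt i (xs , ys))

∣flipAt∣ : ∀ {m} (i : Fin m) P → ∣ flipAt i P ∣ₕ ≡ ∣ P ∣ₕ
∣flipAt∣ zero (true  ∷ xs , true  ∷ ys) = refl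
∣flipAt∣ zero (false ∷ xs , false ∷ ys) = refl
∣flipAt∣ zero (true  ∷ xs , false ∷ ys) = +-suc ∣ xs ∣ ∣ ys ∣
∣flipAt∣ zero (false ∷ xs , true  ∷ ys) = sym (+-suc ∣ xs ∣ ∣ ys ∣)
∣flipAt∣ (suc i) (x ∷ xs , y ∷ ys) = begin
  ∣ Product.map (x ∷_) (y ∷_) (flipAt i (xs , ys)) ∣ₕ  ≡⟨ ∣∷∣ₕ x y (flipAt i (xs , ys)) ⟩
  ∣ x ∷ [] , y ∷ [] ∣ₕ + ∣ flipAt i (xs , ys) ∣ₕ      ≡⟨ cong (∣ x ∷ [] , y ∷ [] ∣ₕ +_) (∣flipAt∣ i (xs , ys)) ⟩
  ∣ x ∷ [] , y ∷ [] ∣ₕ + ∣ xs , ys ∣ₕ                 ≡⟨ ∣∷∣ₕ x y (xs , ys) ⟨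
  ∣ x ∷ xs , y ∷ ys ∣ₕ                               ∎
  where
  open ≡-Reasoning
  ∣∷∣ₕ : ∀ {m} x y (P : Halves m) → ∣ Product.map (x ∷_) (y ∷_) P ∣ₕ ≡ ∣ x ∷ [] , y ∷ [] ∣ₕ + ∣ P ∣ₕ
  ∣∷∣ₕ true  true  (xs , ys) = cong suc (+-suc ∣ xs ∣ ∣ ys ∣)
  ∣∷∣ₕ true  false (xs , ys) = refl
  ∣∷∣ₕ false true  (xs , ys) = +-suc ∣ xs ∣ ∣ ys ∣
  ∣∷∣ₕ false false (xs , ys) = refl

lookup-flipAt : ∀ {m} (i : Fin m) P → lookup (proj₁ (flipAt i P)) i ≡ lookup (proj₂ P) i
lookup-flipAt zero    (x ∷ xs , y ∷ ys) = refl
lookup-flipAt (suc i) (x ∷ xs , y ∷ ys) = lookup-flipAt i (xs , ys)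

lookup-flipAt-≢ : ∀ {m} (i l : Fin m) s P → l ≢ i → lookup (half s (flipAt i P)) l ≡ lookup (half s P) l
lookup-flipAt-≢ zero    zero    s     P                 l≢i = ⊥-elim (l≢i refl)
lookup-flipAt-≢ zero    (suc l) true  (x ∷ xs , y ∷ ys) l≢i = refl
lookup-flipAt-≢ zero    (suc l) false (x ∷ xs , y ∷ ys) l≢i = refl
lookup-flipAt-≢ (suc i) zero    true  (x ∷ xs , y ∷ ys) l≢i = refl
lookup-flipAt-≢ (suc i) zero    false (x ∷ xs , y ∷ ys) l≢i = refl
lookup-flipAt-≢ (suc i) (suc l) true  (x ∷ xs , y ∷ ys) l≢i = lookup-flipAt-≢ i l true  (xs , ys) (l≢i ∘ cong suc)
lookup-flipAt-≢ (suc i) (suc l) false (x ∷ xs , y ∷ ys) l≢i = lookup-flipAt-≢ i l false (xs , ys) (l≢i ∘ cong suc)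

lookup-flipAt-split : ∀ {m} (i : Fin m) P → lookup (splits P) i ≡ true →
                      lookup (proj₁ (flipAt i P)) i ≡ not (lookup (proj₁ P) i)
lookup-flipAt-split i (xs , ys) split-at-i =
  trans (lookup-flipAt i (xs , ys)) (xor≡true (trans (sym (lookup-zipWith _xor_ i xs ys)) split-at-i))
  where
  xor≡true : ∀ {x y} → x xor y ≡ true → y ≡ not x
  xor≡true {true}  {false} _ = refl
  xor≡true {false} {true}  _ = refl

-- Extending a colouring of the subsets of [m] to the m-sets of [m + m]

third : ∀ {n} → Fin (3 + n) → Fin (3 + n) → Fin (3 + n)
third zero       (suc zero) = suc (suc zero)
third (suc zero) zero       = suc (suc zero)
third zero       _          = suc zero
third _          zero       = suc zero
third _          _          = zero

third-fresh : ∀ {n} (u w : Fin (3 + n)) → third u w ≢ u × third u w ≢ w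
third-fresh zero          (suc zero)    = (λ ()) , (λ ())
third-fresh (suc zero)    zero          = (λ ()) , (λ ())
third-fresh zero          zero          = (λ ()) , (λ ())
third-fresh zero          (suc (suc w)) = (λ ()) , (λ ())
third-fresh (suc (suc u)) zero          = (λ ()) , (λ ())
third-fresh (suc zero)    (suc w)       = (λ ()) , (λ ())
third-fresh (suc (suc u)) (suc w)       = (λ ()) , (λ ())

-- The number of sets B ⊔ B of colour b under the extension of g that contain the point j of
-- either half; for even m these are the (m/2)-sets B ∋ j of colour b under g.
doubled : ∀ m → (Subset m → Bool) → Bool → Fin m → ℕ
doubled m g b j = ∑[ B ⊆ m ] ([ lookup B j ]· [ does (∣ B ∣ + ∣ B ∣ ≟ m) ]· [ does (g B Bool.≟ b) ]· 1)

module Extension {n : ℕ} (g : Subset (3 + n) → Bool) where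

  M : ℕ
  M = 3 + n

  colourBy : Splitting M → Halves M → Bool
  colourBy none       (xs , _) = g xs
  colourBy (one k)    (xs , _) = lookup xs (sucmod k)
  colourBy (many u w) (xs , _) = lookup xs u xor lookup xs w xor lookup xs (third u w)

  colour : Halves M → Bool
  colour P = colourBy (classify (splits P)) P

  colouring : Colouring (M + M)
  colouring = colour ∘ halves M

  weight : Bool → Halves M → ℕ
  weight b P = [ does (∣ P ∣ₕ ≟ M) ]· [ does (colour P Bool.≟ b) ]· 1

  classWeight : (Splitting M → Bool) → Bool → Halves M → ℕ
  classWeight class b P = [ class (classify (splits P)) ]· weight b P

  contribution : (Splitting M → Bool) → Bool → Fin M → Bool → ℕ
  contribution class b j s = ∑[ P ⊆² M ] ([ lookup (half s P) j ]· classWeight class b P)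

  count-contributions : ∀ b j s → count (M + M) M colouring b (point j s) ≡
    contribution isNone b j s + (contribution isOne b j s + contribution isMany b j s)
  count-contributions b j s = begin
    count (M + M) M colouring b (point j s)                ≡⟨ count-point M colour b j s ⟩
    ∑[ P ⊆² M ] ([ lookup (half s P) j ]· weight b P)      ≡⟨ ∑ₕ-cong M split ⟩
    ∑[ P ⊆² M ] (part isNone P + (part isOne P + part isMany P))
      ≡⟨ trans (∑ₕ-distrib-+ M (part isNone) (λ P → part isOne P + part isMany P))
               (cong (contribution isNone b j s +_) (∑ₕ-distrib-+ M (part isOne) (part isMany))) ⟩
    contribution isNone b j s + (contribution isOne b j s + contribution isMany b j s) ∎
    where
    open ≡-Reasoning
    part : (Splitting M → Bool) → Halves M → ℕ
    part class P = [ lookup (half s P) j ]· classWeight class b P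
    trichotomy : ∀ c x → x ≡ [ isNone c ]· x + ([ isOne c ]· x + [ isMany c ]· x)
    trichotomy none       x = sym (+-identityʳ x)
    trichotomy (one _)    x = sym (+-identityʳ x)
    trichotomy (many _ _) x = refl
    split : ∀ P → [ lookup (half s P) j ]· weight b P ≡ part isNone P + (part isOne P + part isMany P)
    split P = begin
      [ ℓ ]· weight b P
        ≡⟨ cong ([ ℓ ]·_) (trichotomy c (weight b P)) ⟩
      [ ℓ ]· ([ isNone c ]· weight b P + ([ isOne c ]· weight b P + [ isMany c ]· weight b P))
        ≡⟨ trans ([]·-distrib-+ ℓ _ _) (cong (part isNone P +_) ([]·-distrib-+ ℓ _ _)) ⟩
      part isNone P + (part isOne P + part isMany P) ∎
      where
      ℓ : Bool
      ℓ = lookup (half s P) j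
      c : Splitting M
      c = classify (splits P)

  contribution-none : ∀ b j s → contribution isNone b j s ≡ doubled M g b j
  contribution-none b j s = ∑ₛ-cong M λ xs → begin
    ∑[ ys ⊆ M ] ([ lookup (half s (xs , ys)) j ]· classWeight isNone b (xs , ys))
      ≡⟨ ∑ₛ-cong M (λ ys → []·-comm (lookup (half s (xs , ys)) j) (isNone (classify (splits (xs , ys))))
                                    (weight b (xs , ys))) ⟩
    ∑[ ys ⊆ M ] ([ isNone (classify (splits (xs , ys))) ]· [ lookup (half s (xs , ys)) j ]· weight b (xs , ys))
      ≡⟨ ∑ₛ-cong M (λ ys → cong ([_]· [ lookup (half s (xs , ys)) j ]· weight b (xs , ys))
                                (isNone-classify (splits (xs , ys)))) ⟩
    ∑[ ys ⊆ M ] ([ ∣ splits (xs , ys) ∣ ≡ᵇ 0 ]· [ lookup (half s (xs , ys)) j ]· weight b (xs , ys))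
      ≡⟨ ∑ₛ-unsplit xs (λ ys → [ lookup (half s (xs , ys)) j ]· weight b (xs , ys)) ⟩
    [ lookup (half s (xs , xs)) j ]· weight b (xs , xs)
      ≡⟨ cong₂ (λ ℓ κ → [ ℓ ]· [ does (∣ xs ∣ + ∣ xs ∣ ≟ M) ]· [ does (κ Bool.≟ b) ]· 1)
               (cong (λ B → lookup B j) (half-diagonal s)) (cong (λ c → colourBy c (xs , xs)) (classify-diagonal xs)) ⟩
    [ lookup xs j ]· [ does (∣ xs ∣ + ∣ xs ∣ ≟ M) ]· [ does (g xs Bool.≟ b) ]· 1 ∎
    where open ≡-Reasoning

  other : Fin M → Fin M → Fin M → Fin M
  other j u w = if does (u Fin.≟ j) then w else u

  other-spec : ∀ j u w → u ≢ w → (other j u w ≡ u ⊎ other j u w ≡ w) × other j u w ≢ j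
  other-spec j u w u≢w with u Fin.≟ j
  ... | yes refl = inj₂ refl , u≢w ∘ sym
  ... | no  u≢j  = inj₁ refl , u≢j

  flipAwayFrom : Fin M → Splitting M → Halves M → Halves M
  flipAwayFrom j (many u w) = flipAt (other j u w)
  flipAwayFrom j _          = id

  flipAway : Fin M → Halves M → Halves M
  flipAway j P = flipAwayFrom j (classify (splits P)) P

  flipAway-involutive : ∀ j P → flipAway j (flipAway j P) ≡ P
  flipAway-involutive j P with classify (splits P) in c
  ... | none     rewrite c = refl
  ... | one _    rewrite c = refl
  ... | many u w rewrite splits-flipAt (other j u w) P | c = flipAt-involutive (other j u w) P

  colour-flipAt : ∀ P {u w} i → classify (splits P) ≡ many u w → i ≡ u ⊎ i ≡ w →
                  colour (flipAt i P) ≡ not (colour P)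
  colour-flipAt P@(xs , _) {u} {w} i c i∈uw = begin
    colourBy (classify (splits (flipAt i P))) (flipAt i P)
      ≡⟨ cong (λ c → colourBy c (flipAt i P)) (trans (cong classify (splits-flipAt i P)) c) ⟩
    x′ u xor x′ w xor x′ t
      ≡⟨ flip-one i∈uw ⟩
    not (x u xor x w xor x t)
      ≡⟨ cong (λ c → not (colourBy c P)) c ⟨
    not (colour P) ∎
    where
    open ≡-Reasoning
    x x′ : Fin M → Bool
    x  l = lookup xs l
    x′ l = lookup (proj₁ (flipAt i P)) l
    t : Fin M
    t = third u w
    split-u : lookup (splits P) u ≡ true
    split-u = proj₁ (classify-many (splits P) c)
    split-w : lookup (splits P) w ≡ true
    split-w = proj₁ (proj₂ (classify-many (splits P) c))
    u≢w : u ≢ w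
    u≢w = proj₂ (proj₂ (classify-many (splits P) c))
    t≢u : t ≢ u
    t≢u = proj₁ (third-fresh u w)
    t≢w : t ≢ w
    t≢w = proj₂ (third-fresh u w)
    flipped : ∀ {l} → l ≡ i → lookup (splits P) l ≡ true → x′ l ≡ not (x l)
    flipped refl = lookup-flipAt-split i P
    kept : ∀ {l v} → l ≢ v → i ≡ v → x′ l ≡ x l
    kept l≢v refl = lookup-flipAt-≢ i _ true P l≢v
    flip-one : i ≡ u ⊎ i ≡ w → x′ u xor x′ w xor x′ t ≡ not (x u xor x w xor x t)
    flip-one (inj₁ i≡u) = begin
      x′ u xor x′ w xor x′ t     ≡⟨ cong₂ _xor_ (flipped (sym i≡u) split-u)
                                               (cong₂ _xor_ (kept (u≢w ∘ sym) i≡u) (kept t≢u i≡u)) ⟩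
      not (x u) xor x w xor x t  ≡⟨ Bool.not-distribˡ-xor (x u) (x w xor x t) ⟨
      not (x u xor x w xor x t)  ∎
    flip-one (inj₂ i≡w) = begin
      x′ u xor x′ w xor x′ t     ≡⟨ cong₂ _xor_ (kept u≢w i≡w)
                                               (cong₂ _xor_ (flipped (sym i≡w) split-w) (kept t≢w i≡w)) ⟩
      x u xor not (x w) xor x t  ≡⟨ cong (x u xor_) (Bool.not-distribˡ-xor (x w) (x t)) ⟨
      x u xor not (x w xor x t)  ≡⟨ Bool.not-distribʳ-xor (x u) (x w xor x t) ⟨
      not (x u xor x w xor x t)  ∎

  flipAway-weight : ∀ j s P →
    [ lookup (half s (flipAway j P)) j ]· classWeight isMany true (flipAway j P) ≡
    [ lookup (half s P) j ]· classWeight isMany false P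
  flipAway-weight j s P with classify (splits P) in c
  ... | none  rewrite c = refl
  ... | one _ rewrite c = refl
  ... | many u w = begin
    weightOf (ℓ (flipAt i P)) (classify (splits (flipAt i P))) ∣ flipAt i P ∣ₕ (colour (flipAt i P))
      ≡⟨ cong₂ (λ ℓ′ c′ → weightOf ℓ′ c′ ∣ flipAt i P ∣ₕ (colour (flipAt i P)))
               (lookup-flipAt-≢ i j s P (proj₂ i-spec ∘ sym)) (trans (cong classify (splits-flipAt i P)) c) ⟩
    weightOf (ℓ P) (many u w) ∣ flipAt i P ∣ₕ (colour (flipAt i P))
      ≡⟨ cong₂ (weightOf (ℓ P) (many u w)) (∣flipAt∣ i P)
               (trans (colour-flipAt P i c (proj₁ i-spec)) (cong (λ c′ → not (colourBy c′ P)) c)) ⟩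
    weightOf (ℓ P) (many u w) ∣ P ∣ₕ (not (colourBy (many u w) P))
      ≡⟨ cong (λ d → [ ℓ P ]· [ does (∣ P ∣ₕ ≟ M) ]· [ d ]· 1) (not-≟-true (colourBy (many u w) P)) ⟩
    [ ℓ P ]· [ does (∣ P ∣ₕ ≟ M) ]· [ does (colourBy (many u w) P Bool.≟ false) ]· 1 ∎
    where
    open ≡-Reasoning
    i : Fin M
    i = other j u w
    i-spec : (i ≡ u ⊎ i ≡ w) × i ≢ j
    i-spec = other-spec j u w (proj₂ (proj₂ (classify-many (splits P) c)))
    ℓ : Halves M → Bool
    ℓ Q = lookup (half s Q) j
    weightOf : Bool → Splitting M → ℕ → Bool → ℕ
    weightOf ℓ′ c′ k κ = [ ℓ′ ]· [ isMany c′ ]· [ does (k ≟ M) ]· [ does (κ Bool.≟ true) ]· 1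

  contribution-many : ∀ j s → contribution isMany true j s ≡ contribution isMany false j s
  contribution-many j s = begin
    contribution isMany true j s
      ≡⟨ ∑ₕ-reindex M (flipAway j) (flipAway j) (flipAway-involutive j) (flipAway-involutive j) f ⟨
    ∑[ P ⊆² M ] f (flipAway j P)
      ≡⟨ ∑ₕ-cong M (flipAway-weight j s) ⟩
    contribution isMany false j s ∎
    where
    open ≡-Reasoning
    f : Halves M → ℕ
    f P = [ lookup (half s P) j ]· classWeight isMany true P

  colourBy-∁ₕ : ∀ c P → isNone c ≡ false → colourBy c (∁ₕ P) ≡ not (colourBy c P)
  colourBy-∁ₕ (one k)    (xs , _) _ = lookup-map (sucmod k) not xs
  colourBy-∁ₕ (many u w) (xs , _) _ = begin
    lookup (∁ xs) u xor lookup (∁ xs) w xor lookup (∁ xs) t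
      ≡⟨ cong₂ _xor_ (lookup-map u not xs) (cong₂ _xor_ (lookup-map w not xs) (lookup-map t not xs)) ⟩
    not (x u) xor not (x w) xor not (x t)   ≡⟨ cong (not (x u) xor_) (not-xor-not (x w) (x t)) ⟩
    not (x u) xor x w xor x t               ≡⟨ Bool.not-distribˡ-xor (x u) (x w xor x t) ⟨
    not (x u xor x w xor x t)               ∎
    where
    open ≡-Reasoning
    t : Fin M
    t = third u w
    x : Fin M → Bool
    x = lookup xs

  classWeight-one-invariant : ∀ Q P → isOne (classify (splits Q)) ≡ isOne (classify (splits P)) →
    ∣ Q ∣ₕ ≡ ∣ P ∣ₕ → (isOne (classify (splits P)) ≡ true → colour Q ≡ colour P) →
    ∀ b → classWeight isOne b Q ≡ classWeight isOne b P
  classWeight-one-invariant Q P one-eq size-eq colour-eq b = []·-cong one-eq λ isOne-Q →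
    cong₂ (λ k κ → [ does (k ≟ M) ]· [ does (κ Bool.≟ b) ]· 1) size-eq (colour-eq (trans (sym one-eq) isOne-Q))

  classWeight-one-swap : ∀ b P → classWeight isOne b (swap P) ≡ classWeight isOne b P
  classWeight-one-swap b P@(xs , ys) =
    classWeight-one-invariant (swap P) P (cong (isOne ∘ classify) (splits-swap P)) (+-comm ∣ ys ∣ ∣ xs ∣) colour-eq b
    where
    colour-eq : isOne (classify (splits P)) ≡ true → colour (swap P) ≡ colour P
    colour-eq isOne-P with isOne⇒one isOne-P
    ... | k , c = begin
      colourBy (classify (splits (swap P))) (swap P)
        ≡⟨ cong (λ c′ → colourBy c′ (swap P)) (trans (cong classify (splits-swap P)) c) ⟩
      lookup ys (sucmod k)  ≡⟨ unsplit-next ⟨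
      lookup xs (sucmod k)  ≡⟨ cong (λ c′ → colourBy c′ P) c ⟨
      colour P              ∎
      where
      open ≡-Reasoning
      unsplit-next : lookup xs (sucmod k) ≡ lookup ys (sucmod k)
      unsplit-next with lookup (splits P) (sucmod k) in split
      ... | false = unsplit-column P (sucmod k) split
      ... | true  = ⊥-elim (sucmod-≢ k (proj₂ (classify-one (splits P) c) (sucmod k) split))

  classWeight-one-rot : ∀ b P → classWeight isOne b (rotₕ P) ≡ classWeight isOne b P
  classWeight-one-rot b P@(xs , ys) = classWeight-one-invariant (rotₕ P) P isOne-eq (∣rotₕ∣ P) colour-eq b
    where
    open ≡-Reasoning
    isOne-eq : isOne (classify (splits (rotₕ P))) ≡ isOne (classify (splits P))
    isOne-eq = begin
      isOne (classify (splits (rotₕ P)))  ≡⟨ isOne-classify (splits (rotₕ P)) ⟩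
      ∣ splits (rotₕ P) ∣ ≡ᵇ 1            ≡⟨ cong (λ v → ∣ v ∣ ≡ᵇ 1) (splits-rotₕ P) ⟩
      ∣ rot (splits P) ∣ ≡ᵇ 1             ≡⟨ cong (_≡ᵇ 1) (∣rot∣ (splits P)) ⟩
      ∣ splits P ∣ ≡ᵇ 1                   ≡⟨ isOne-classify (splits P) ⟨
      isOne (classify (splits P))         ∎
    colour-eq : isOne (classify (splits P)) ≡ true → colour (rotₕ P) ≡ colour P
    colour-eq isOne-P with isOne⇒one isOne-P | isOne⇒one (trans isOne-eq isOne-P)
    ... | k , c | k′ , c′ = begin
      colourBy (classify (splits (rotₕ P))) (rotₕ P)  ≡⟨ cong (λ c″ → colourBy c″ (rotₕ P)) c′ ⟩
      lookup (rot xs) (sucmod k′)                      ≡⟨ lookup-rot xs (sucmod k′) ⟩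
      lookup xs (sucmod (sucmod k′))                   ≡⟨ cong (lookup xs ∘ sucmod) next-k′ ⟩
      lookup xs (sucmod k)                             ≡⟨ cong (λ c″ → colourBy c″ P) c ⟨
      colour P                                         ∎
      where
      next-k′ : sucmod k′ ≡ k
      next-k′ = proj₂ (classify-one (splits P) c) (sucmod k′) (begin
        lookup (splits P) (sucmod k′)      ≡⟨ lookup-rot (splits P) k′ ⟨
        lookup (rot (splits P)) k′         ≡⟨ cong (λ v → lookup v k′) (splits-rotₕ P) ⟨
        lookup (splits (rotₕ P)) k′        ≡⟨ proj₁ (classify-one (splits (rotₕ P)) c′) ⟩
        true                               ∎)

  classWeight-one-∁ₕ : ∀ P → classWeight isOne true (∁ₕ P) ≡ classWeight isOne false P
  classWeight-one-∁ₕ P = []·-cong (cong (isOne ∘ classify) (splits-∁ₕ P)) λ isOne-∁P →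
    cong₂ (λ d d′ → [ d ]· [ d′ ]· 1) size-eq (colour-eq isOne-∁P)
    where
    size-eq : does (∣ ∁ₕ P ∣ₕ ≟ M) ≡ does (∣ P ∣ₕ ≟ M)
    size-eq = does-⇔ (mk⇔ (λ e → subst (λ Q → ∣ Q ∣ₕ ≡ M) (∁ₕ-involutive P) (∣∁ₕ∣ (∁ₕ P) e)) (∣∁ₕ∣ P))
                       (∣ ∁ₕ P ∣ₕ ≟ M) (∣ P ∣ₕ ≟ M)
    colour-eq : isOne (classify (splits (∁ₕ P))) ≡ true →
                does (colour (∁ₕ P) Bool.≟ true) ≡ does (colour P Bool.≟ false)
    colour-eq isOne-∁P with isOne⇒one isOne-∁P
    ... | k , c = begin
      does (colourBy (classify (splits (∁ₕ P))) (∁ₕ P) Bool.≟ true)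
        ≡⟨ cong (λ c′ → does (colourBy c′ (∁ₕ P) Bool.≟ true)) c ⟩
      does (colourBy (one k) (∁ₕ P) Bool.≟ true)
        ≡⟨ cong (λ κ → does (κ Bool.≟ true)) (colourBy-∁ₕ (one k) P refl) ⟩
      does (not (colourBy (one k) P) Bool.≟ true)
        ≡⟨ not-≟-true (colourBy (one k) P) ⟩
      does (colourBy (one k) P Bool.≟ false)
        ≡⟨ cong (λ c′ → does (colourBy c′ P Bool.≟ false)) (trans (cong classify (sym (splits-∁ₕ P))) c) ⟨
      does (colour P Bool.≟ false) ∎
      where open ≡-Reasoning

  contribution-one-swap : ∀ b j → contribution isOne b j true ≡ contribution isOne b j false
  contribution-one-swap b j = begin
    contribution isOne b j true
      ≡⟨ ∑ₕ-reindex M swap swap (λ _ → refl) (λ _ → refl) (λ P → [ lookup (proj₁ P) j ]· classWeight isOne b P)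
       ⟨
    ∑[ P ⊆² M ] ([ lookup (proj₂ P) j ]· classWeight isOne b (swap P))
      ≡⟨ ∑ₕ-cong M (λ P → cong ([ lookup (proj₂ P) j ]·_) (classWeight-one-swap b P)) ⟩
    contribution isOne b j false ∎
    where open ≡-Reasoning

  contribution-one-rot : ∀ b i s → contribution isOne b (Fin.inject₁ i) s ≡ contribution isOne b (suc i) s
  contribution-one-rot b i s = begin
    contribution isOne b (Fin.inject₁ i) s
      ≡⟨ ∑ₕ-reindex M rotₕ unrotₕ unrotₕ-rotₕ rotₕ-unrotₕ
                    (λ P → [ lookup (half s P) (Fin.inject₁ i) ]· classWeight isOne b P) ⟨
    ∑[ P ⊆² M ] ([ lookup (half s (rotₕ P)) (Fin.inject₁ i) ]· classWeight isOne b (rotₕ P))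
      ≡⟨ ∑ₕ-cong M (λ P → cong₂ [_]·_ (next P) (classWeight-one-rot b P)) ⟩
    contribution isOne b (suc i) s ∎
    where
    open ≡-Reasoning
    next : ∀ P → lookup (half s (rotₕ P)) (Fin.inject₁ i) ≡ lookup (half s P) (suc i)
    next P = begin
      lookup (half s (rotₕ P)) (Fin.inject₁ i)      ≡⟨ cong (λ v → lookup v (Fin.inject₁ i)) (half-rotₕ s P) ⟩
      lookup (rot (half s P)) (Fin.inject₁ i)       ≡⟨ lookup-rot (half s P) (Fin.inject₁ i) ⟩
      lookup (half s P) (sucmod (Fin.inject₁ i))    ≡⟨ cong (lookup (half s P)) (sucmod-inject₁ i) ⟩
      lookup (half s P) (suc i)                     ∎

  contribution-one-constant : ∀ b j s → contribution isOne b j s ≡ contribution isOne b zero true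
  contribution-one-constant b j true  = <-weakInduction (λ j → contribution isOne b j true ≡ contribution isOne b zero true)
    refl (λ i eq → trans (sym (contribution-one-rot b i true)) eq) j
  contribution-one-constant b j false = trans (sym (contribution-one-swap b j)) (contribution-one-constant b j true)

  total-one : Bool → ℕ
  total-one b = ∑ₕ M (classWeight isOne b)

  contribution-one-double-counting : ∀ b → (M + M) * contribution isOne b zero true ≡ M * total-one b
  contribution-one-double-counting b = begin
    (M + M) * contribution isOne b zero true
      ≡⟨ sum-const (M + M) (contribution isOne b zero true) ⟨
    sum {M + M} (λ _ → contribution isOne b zero true)
      ≡⟨ sum-cong-≗ {M + M} (λ x → sym (point-constant x)) ⟩
    sum {M + M} (λ x → ∑[ A ⊆ M + M ] ([ lookup A x ]· classWeight isOne b (halves M A)))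
      ≡⟨ double-counting (M + M) (classWeight isOne b ∘ halves M) ⟩
    ∑[ A ⊆ M + M ] (∣ A ∣ * classWeight isOne b (halves M A))
      ≡⟨ ∑ₛ-cong (M + M) (λ A → trans (cong (_* classWeight isOne b (halves M A)) (sym (∣halves∣ M A)))
                                     (sized (halves M A))) ⟩
    ∑[ A ⊆ M + M ] (M * classWeight isOne b (halves M A))
      ≡⟨ ∑ₛ-distribˡ-* (M + M) M (classWeight isOne b ∘ halves M) ⟩
    M * ∑[ A ⊆ M + M ] classWeight isOne b (halves M A)
      ≡⟨ cong (M *_) (∑ₛ-halves M (classWeight isOne b)) ⟩
    M * total-one b ∎
    where
    open ≡-Reasoning
    point-constant : ∀ x →
      ∑[ A ⊆ M + M ] ([ lookup A x ]· classWeight isOne b (halves M A)) ≡ contribution isOne b zero true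
    point-constant x with point-surjective {M} x
    ... | j , s , refl = trans (∑ₛ-cong (M + M) λ A → cong ([_]· classWeight isOne b (halves M A)) (lookup-halves A))
                         (trans (∑ₛ-halves M (λ P → [ lookup (half s P) j ]· classWeight isOne b P))
                                (contribution-one-constant b j s))
      where
      lookup-halves : ∀ A → lookup A (point j s) ≡ lookup (half s (halves M A)) j
      lookup-halves A = trans (cong (λ A′ → lookup A′ (point j s)) (sym (join-halves M A))) (lookup-join (halves M A) j s)
    sized : ∀ P → ∣ P ∣ₕ * classWeight isOne b P ≡ M * classWeight isOne b P
    sized P = restrict (isOne (classify (splits P))) ∣ P ∣ₕ (∣ P ∣ₕ ≟ M) ([ does (colour P Bool.≟ b) ]· 1)
      where
      restrict : ∀ q k (k≟M : Dec (k ≡ M)) x → k * ([ q ]· [ does k≟M ]· x) ≡ M * ([ q ]· [ does k≟M ]· x)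
      restrict false k _          x = trans (*-zeroʳ k) (sym (*-zeroʳ M))
      restrict true  k (yes refl) x = refl
      restrict true  k (no _)     x = trans (*-zeroʳ k) (sym (*-zeroʳ M))

  total-one-∁ₕ : total-one true ≡ total-one false
  total-one-∁ₕ = trans (sym (∑ₕ-reindex M ∁ₕ ∁ₕ ∁ₕ-involutive ∁ₕ-involutive (classWeight isOne true)))
                       (∑ₕ-cong M classWeight-one-∁ₕ)

  contribution-one : ∀ j s → contribution isOne true j s ≡ contribution isOne false j s
  contribution-one j s = begin
    contribution isOne true j s      ≡⟨ contribution-one-constant true j s ⟩
    contribution isOne true zero true
      ≡⟨ *-cancelˡ-≡ _ _ (M + M) (begin
           (M + M) * contribution isOne true zero true   ≡⟨ contribution-one-double-counting true ⟩
           M * total-one true                            ≡⟨ cong (M *_) total-one-∁ₕ ⟩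
           M * total-one false                           ≡⟨ contribution-one-double-counting false ⟨
           (M + M) * contribution isOne false zero true  ∎) ⟩
    contribution isOne false zero true  ≡⟨ contribution-one-constant false j s ⟨
    contribution isOne false j s     ∎
    where open ≡-Reasoning

  balance : ∀ j s → red (M + M) M colouring (point j s) + doubled M g false j ≡
                    blue (M + M) M colouring (point j s) + doubled M g true j
  balance j s = begin
    red (M + M) M colouring (point j s) + doubled M g false j
      ≡⟨ cong (_+ doubled M g false j) (count-contributions true j s) ⟩
    (contribution isNone true j s + (contribution isOne true j s + contribution isMany true j s)) + doubled M g false j
      ≡⟨ cong₂ (λ d r → (d + r) + doubled M g false j) (contribution-none true j s)
               (cong₂ _+_ (contribution-one j s) (contribution-many j s)) ⟩
    (doubled M g true j + rest) + doubled M g false j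
      ≡⟨ swap-ends (doubled M g true j) rest (doubled M g false j) ⟩
    (doubled M g false j + rest) + doubled M g true j
      ≡⟨ cong (λ d → (d + rest) + doubled M g true j) (contribution-none false j s) ⟨
    (contribution isNone false j s + rest) + doubled M g true j
      ≡⟨ cong (_+ doubled M g true j) (count-contributions false j s) ⟨
    blue (M + M) M colouring (point j s) + doubled M g true j ∎
    where
    open ≡-Reasoning
    rest : ℕ
    rest = contribution isOne false j s + contribution isMany false j s
    swap-ends : ∀ a r b → (a + r) + b ≡ (b + r) + a
    swap-ends a r b = trans (+-comm (a + r) b) (trans (cong (b +_) (+-comm a r)) (sym (+-assoc b r a)))

  colour-∁ₕ : (∀ B → ∣ B ∣ + ∣ B ∣ ≡ M → g (∁ B) ≡ not (g B)) →
              ∀ P → ∣ P ∣ₕ ≡ M → colour (∁ₕ P) ≡ not (colour P)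
  colour-∁ₕ g-∁ P@(xs , ys) ∣P∣≡M =
    trans (cong (λ c → colourBy (classify c) (∁ₕ P)) (splits-∁ₕ P)) (by-class (classify (splits P)) refl)
    where
    by-class : ∀ c → classify (splits P) ≡ c → colourBy c (∁ₕ P) ≡ not (colour P)
    by-class none c = trans (g-∁ xs ∣xs∣+∣xs∣≡M) (cong (λ c′ → not (colourBy c′ P)) (sym c))
      where
      ∣xs∣+∣xs∣≡M : ∣ xs ∣ + ∣ xs ∣ ≡ M
      ∣xs∣+∣xs∣≡M = trans (cong (λ zs → ∣ xs ∣ + ∣ zs ∣) (unsplit⇒diagonal P (classify-none (splits P) c))) ∣P∣≡M
    by-class (one k)    c = trans (colourBy-∁ₕ (one k) P refl) (cong (λ c′ → not (colourBy c′ P)) (sym c))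
    by-class (many u w) c = trans (colourBy-∁ₕ (many u w) P refl) (cong (λ c′ → not (colourBy c′ P)) (sym c))

  complement-distinct : (∀ B → ∣ B ∣ + ∣ B ∣ ≡ M → g (∁ B) ≡ not (g B)) → ComplementDistinct M colouring
  complement-distinct g-∁ A ∣A∣≡M = Bool.not-¬ refl ∘ flip trans (begin
    colour (halves M (∁ A))                   ≡⟨ cong (colour ∘ halves M ∘ ∁) (join-halves M A) ⟨
    colour (halves M (∁ (join (halves M A)))) ≡⟨ cong (colour ∘ halves M) (∁-join (halves M A)) ⟩
    colour (halves M (join (∁ₕ (halves M A)))) ≡⟨ cong colour (halves-join (∁ₕ (halves M A))) ⟩
    colour (∁ₕ (halves M A))                  ≡⟨ colour-∁ₕ g-∁ (halves M A) (trans (∣halves∣ M A) ∣A∣≡M) ⟩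
    not (colouring A)                         ∎)
    where open ≡-Reasoning

-- Doubling

Inherits : ∀ m → Colouring (m + m) → (Bool → Fin m → ℕ) → Set
Inherits m c D = ∀ j s → red (m + m) m c (point j s) + D false j ≡ blue (m + m) m c (point j s) + D true j

+-transfer : ∀ {a b x y} d → a + x ≡ b + y → y ≡ x + d → a ≡ b + d
+-transfer {a} {b} {x} {y} d a+x≡b+y y≡x+d = +-cancelʳ-≡ x a (b + d) (begin
  a + x        ≡⟨ a+x≡b+y ⟩
  b + y        ≡⟨ cong (b +_) y≡x+d ⟩
  b + (x + d)  ≡⟨ cong (b +_) (+-comm x d) ⟩
  b + (d + x)  ≡⟨ +-assoc b d x ⟨
  b + d + x    ∎)
  where open ≡-Reasoning

extend : ∀ m → 3 ≤ m → (g : Subset m → Bool) → (∀ B → ∣ B ∣ + ∣ B ∣ ≡ m → g (∁ B) ≡ not (g B)) →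
  Σ (Colouring (m + m)) λ c → ComplementDistinct m c × Inherits m c (doubled m g)
extend (suc (suc (suc n))) (s≤s (s≤s (s≤s z≤n))) g g-∁ = colouring , complement-distinct g-∁ , balance
  where open Extension g

2*≡+ : ∀ m → 2 * m ≡ m + m
2*≡+ m = cong (m +_) (+-identityʳ m)

+-double≢suc : ∀ k h → k + k ≢ suc (h + h)
+-double≢suc k h eq = even≢odd k h (trans (2*≡+ k) (trans eq (cong suc (sym (2*≡+ h)))))

+-double-injective : ∀ k h → k + k ≡ h + h → k ≡ h
+-double-injective k h eq = *-cancelˡ-≡ k h 2 (trans (2*≡+ k) (trans eq (sym (2*≡+ h))))

doubled-odd : ∀ h g b j → doubled (suc (h + h)) g b j ≡ 0
doubled-odd h g b j = trans (∑ₛ-cong (suc (h + h)) λ B →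
                        trans (cong (λ d → [ lookup B j ]· [ d ]· [ does (g B Bool.≟ b) ]· 1)
                                    (dec-false (∣ B ∣ + ∣ B ∣ ≟ suc (h + h)) (+-double≢suc ∣ B ∣ h)))
                              ([]·-zero (lookup B j)))
                      (∑ₛ-zero (suc (h + h)))

doubled-even : ∀ h g b j → doubled (h + h) g b j ≡ count (h + h) h g b j
doubled-even h g b j = trans (∑ₛ-cong (h + h) summand) (sym (count≡∑ₛ (h + h) h g b j))
  where
  summand : ∀ B → [ lookup B j ]· [ does (∣ B ∣ + ∣ B ∣ ≟ h + h) ]· [ does (g B Bool.≟ b) ]· 1 ≡
                  [ does (∣ B ∣ ≟ h) ]· [ does (g B Bool.≟ b) ]· [ does (j ∈? B) ]· 1
  summand B rewrite does-∈? j B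
                  | does-⇔ (mk⇔ (+-double-injective ∣ B ∣ h) (λ e → cong₂ _+_ e e)) (∣ B ∣ + ∣ B ∣ ≟ h + h) (∣ B ∣ ≟ h)
                  =
    sym ([]·-rotate (does (∣ B ∣ ≟ h)) (does (g B Bool.≟ b)) (lookup B j) 1)

Balanced : ℕ → Set
Balanced m = Σ (Colouring (m + m)) λ c →
  ComplementDistinct m c × (∀ (x : Fin (m + m)) → red (m + m) m c x ≡ blue (m + m) m c x)

Skewed : ℕ → Set
Skewed m = Σ (Colouring (m + m)) λ c →
  ComplementDistinct m c ×
  Σ (Subset (m + m)) λ P →
    (2 * ∣ P ∣ ≡ m)
    × (∀ (x : Fin (m + m)) → x ∈ P → red (m + m) m c x ≡ blue (m + m) m c x + 3)
    × (∀ (x : Fin (m + m)) → x ∉ P → blue (m + m) m c x ≡ red (m + m) m c x + 1)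

balanced-odd : ∀ h → 1 ≤ h → Balanced (suc (h + h))
balanced-odd h@(suc h′) (s≤s z≤n) =
  let c , c-distinct , inherits = extend m (s≤s (s≤s (≤-trans (s≤s z≤n) (m≤n+m h h′)))) g g-∁ in
  c , c-distinct , λ x → case point-surjective {m} x of λ where
    (j , s , refl) → trans (+-transfer 0 (inherits j s)
                             (trans (doubled-odd h g true j) (sym (trans (+-identityʳ _) (doubled-odd h g false j)))))
                           (+-identityʳ _)
  where
  m : ℕ
  m = suc (h + h)
  g : Subset m → Bool
  g _ = true
  g-∁ : ∀ B → ∣ B ∣ + ∣ B ∣ ≡ m → g (∁ B) ≡ not (g B)
  g-∁ B eq = ⊥-elim (+-double≢suc ∣ B ∣ h eq)

extend-even : ∀ h → 2 ≤ h → (g : Colouring (h + h)) → ComplementDistinct h g →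
  Σ (Colouring ((h + h) + (h + h))) λ c → ComplementDistinct (h + h) c × Inherits (h + h) c (doubled (h + h) g)
extend-even h@(suc (suc h″)) (s≤s (s≤s z≤n)) g g-distinct =
  extend (h + h) (s≤s (s≤s (≤-trans (s≤s z≤n) (m≤n+m h h″)))) g g-∁
  where
  g-∁ : ∀ B → ∣ B ∣ + ∣ B ∣ ≡ h + h → g (∁ B) ≡ not (g B)
  g-∁ B eq = Bool.¬-not (g-distinct B (+-double-injective ∣ B ∣ h eq) ∘ sym)

balanced-double : ∀ h → 2 ≤ h → Balanced h → Balanced (h + h)
balanced-double h 2≤h (g , g-distinct , g-balanced) =
  let c , c-distinct , inherits = extend-even h 2≤h g g-distinct in
  c , c-distinct , λ x → case point-surjective {h + h} x of λ where
    (j , s , refl) → trans (+-transfer 0 (inherits j s) (begin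
      doubled (h + h) g true j   ≡⟨ doubled-even h g true j ⟩
      red (h + h) h g j          ≡⟨ g-balanced j ⟩
      blue (h + h) h g j         ≡⟨ doubled-even h g false j ⟨
      doubled (h + h) g false j  ≡⟨ +-identityʳ _ ⟨
      doubled (h + h) g false j + 0 ∎)) (+-identityʳ _)
  where open ≡-Reasoning

skewed-double : ∀ h → 2 ≤ h → Skewed h → Skewed (h + h)
skewed-double h 2≤h (g , g-distinct , P , 2∣P∣≡h , surplus , deficit) =
  let c , c-distinct , inherits = extend-even h 2≤h g g-distinct in
  c , c-distinct , P ++ P , size ,
  (λ x x∈PP → case point-surjective {h + h} x of λ where
     (j , s , refl) → +-transfer 3 (inherits j s) (begin
       doubled (h + h) g true j       ≡⟨ doubled-even h g true j ⟩
       red (h + h) h g j              ≡⟨ surplus j (lookup⇒[]= j P (trans (sym (lookup-P++P j s)) ([]=⇒lookup x∈PP))) ⟩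
       blue (h + h) h g j + 3         ≡⟨ cong (_+ 3) (doubled-even h g false j) ⟨
       doubled (h + h) g false j + 3  ∎)) ,
  (λ x x∉PP → case point-surjective {h + h} x of λ where
     (j , s , refl) → +-transfer 1 (sym (inherits j s)) (begin
       doubled (h + h) g false j      ≡⟨ doubled-even h g false j ⟩
       blue (h + h) h g j             ≡⟨ deficit j (λ j∈P → x∉PP (lookup⇒[]= (point j s) (P ++ P)
                                                         (trans (lookup-P++P j s) ([]=⇒lookup j∈P)))) ⟩
       red (h + h) h g j + 1          ≡⟨ cong (_+ 1) (doubled-even h g true j) ⟨
       doubled (h + h) g true j + 1   ∎))
  where
  open ≡-Reasoning
  size : 2 * ∣ P ++ P ∣ ≡ h + h
  size = trans (cong (2 *_) (∣++∣ P P)) (trans (*-distribˡ-+ 2 ∣ P ∣ ∣ P ∣) (cong₂ _+_ 2∣P∣≡h 2∣P∣≡h))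
  lookup-P++P : ∀ j s → lookup (P ++ P) (point j s) ≡ lookup P j
  lookup-P++P j s = trans (lookup-join (P , P) j s) (cong (λ B → lookup B j) (half-diagonal s))

skewed-2 : Skewed 2
skewed-2 = (λ A → lookup A zero) , distinct , ⁅ zero ⁆ , refl , surplus , deficit
  where
  distinct : ComplementDistinct 2 (λ A → lookup A zero)
  distinct (a ∷ A) _ = Bool.not-¬ refl
  surplus : ∀ x → x ∈ ⁅ zero ⁆ → red 4 2 (λ A → lookup A zero) x ≡ blue 4 2 (λ A → lookup A zero) x + 3
  surplus zero _ = refl
  surplus (suc x) x∈ = ⊥-elim (Fin.0≢1+n (sym (x∈⁅y⁆⇒x≡y zero x∈)))
  deficit : ∀ x → x ∉ ⁅ zero ⁆ → blue 4 2 (λ A → lookup A zero) x ≡ red 4 2 (λ A → lookup A zero) x + 1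
  deficit zero x∉ = ⊥-elim (x∉ (x∈⁅x⁆ zero))
  deficit (suc zero) _ = refl
  deficit (suc (suc zero)) _ = refl
  deficit (suc (suc (suc zero))) _ = refl

skewed-power : ∀ k → Skewed (2 ^ suc k)
skewed-power zero    = skewed-2
skewed-power (suc k) = subst Skewed (sym (2*≡+ (2 ^ suc k)))
  (skewed-double (2 ^ suc k) (*-monoʳ-≤ 2 (m^n>0 2 k)) (skewed-power k))

data Parity : ℕ → Set where
  even : ∀ h → Parity (h + h)
  odd  : ∀ h → Parity (suc (h + h))

parity : ∀ m → Parity m
parity zero    = even 0
parity (suc m) with parity m
... | even h = odd h
... | odd  h = subst Parity (+-suc (suc h) h) (even (suc h))

balanced : ∀ m → 2 ≤ m → ¬ IsPowerOf2 m → Balanced m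
balanced = <-rec (λ m → 2 ≤ m → ¬ IsPowerOf2 m → Balanced m) λ m rec → by-parity m (parity m) rec
  where
  by-parity : ∀ m → Parity m → (∀ {h} → h < m → 2 ≤ h → ¬ IsPowerOf2 h → Balanced h) →
              2 ≤ m → ¬ IsPowerOf2 m → Balanced m
  by-parity _ (odd zero)             _   (s≤s ()) _
  by-parity _ (odd h@(suc _))        _   _        _   = balanced-odd h (s≤s z≤n)
  by-parity _ (even 0)               _   ()       _
  by-parity _ (even 1)               _   _        ¬2ᵏ = ⊥-elim (¬2ᵏ (1 , refl))
  by-parity _ (even h@(suc (suc _))) rec _        ¬2ᵏ =
    balanced-double h (s≤s (s≤s z≤n)) (rec (m<m+n h (s≤s z≤n)) (s≤s (s≤s z≤n)) λ (k , h≡2ᵏ) →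
      ¬2ᵏ (suc k , trans (cong₂ _+_ h≡2ᵏ h≡2ᵏ) (sym (2*≡+ (2 ^ k)))))

theorem4 : (m : ℕ) → 2 ≤ m →
    (¬ IsPowerOf2 m →
      Σ (Colouring (m + m)) λ c →
        ComplementDistinct m c × (∀ (x : Fin (m + m)) → red (m + m) m c x ≡ blue (m + m) m c x))
    × (IsPowerOf2 m →
      Σ (Colouring (m + m)) λ c →
        ComplementDistinct m c ×
        Σ (Subset (m + m)) λ P →
          (2 * ∣ P ∣ ≡ m)
          × (∀ (x : Fin (m + m)) → x ∈ P → red (m + m) m c x ≡ blue (m + m) m c x + 3)
          × (∀ (x : Fin (m + m)) → x ∉ P → blue (m + m) m c x ≡ red (m + m) m c x + 1))
theorem4 m 2≤m = balanced m 2≤m , λ where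
  (zero  , refl) → case 2≤m of λ { (s≤s ()) }
  (suc k , refl) → skewed-power k
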